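{- Let $\ell\ge 1$ and $m\ge 0$ be integers and $N\in\mathbb{Z}$. Then $$\det\begin{pmatrix} f(N+(m+1)\ell,x,s) & f((m+1)\ell,x,s)\\ f(N+m\ell,x,q^{\ell}s) & f(m\ell,x,q^{\ell}s)\end{pmatrix}=(-1)^{m\ell-1}s^{m\ell}q^{\frac{m\ell((m+2)\ell-1)}{2}}f(\ell,x,s)\,f(N,x,q^{(m+1)\ell}s).$$
   Context: The (Carlitz) $q$-Fibonacci polynomials $f(n,x,s)$ are defined by $f(n,x,s)=xf(n-1,x,s)+q^{n-2}sf(n-2,x,s)$ with $f(0,x,s)=0$, $f(1,x,s)=1$. The same recurrence, run backwards, extends the definition to all integers $n$ (the values are then rational functions in $x,s,q$); the recurrence holds for all $n\in\mathbb{Z}$. -}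

module Defs where

open import Level using (Level)
open import Algebra.Bundles using (CommutativeRing)
open import Data.Nat as ℕ using (ℕ; zero; suc)
open import Data.Integer as ℤ using (ℤ; +_; -[1+_])
open import Data.Product using (_×_; _,_; proj₁; proj₂)

-- Everything is relative to a commutative ring R (e.g. the ring
-- ℤ[x, s^{±1}, q^{±1}] in which the q-Fibonacci values live).
module QFib {c ℓ : Level} (R : CommutativeRing c ℓ) where
  open CommutativeRing R

  pow : Carrier → ℕ → Carrier
  pow a zero    = 1#
  pow a (suc n) = a * pow a n

  -- (-1)^k for an integer exponent k (well defined since (-1)⁻¹ = -1)
  signPow : ℤ → Carrier
  signPow k = pow (- 1#) ℤ.∣ k ∣

  module _ (q x s sinv : Carrier) where
    fwd : ℕ → Carrier × Carrier
    fwd zero    = 0# , 1#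
    fwd (suc n) = let (a , b) = fwd n in b , (x * b + pow q n * s * a)

    -- backward pairs (f(-k), f(1-k)) for k ≥ 0; the recurrence at index 1-k,
    -- f(1-k) = x f(-k) + q^{-k-1} s f(-k-1), solved for f(-k-1)
    -- (sinv is the inverse of s):
    -- f(-k-1) = q^{k+1} s⁻¹ (f(1-k) - x f(-k))
    bwd : ℕ → Carrier × Carrier
    bwd zero    = 0# , 1#
    bwd (suc k) = let (a , b) = bwd k in
                  (pow q (suc k) * sinv * (b - x * a)) , a

    -- Carlitz q-Fibonacci polynomial f(n, x, s) for n ∈ ℤ
    -- (meaningful when s * sinv ≈ 1)
    f : ℤ → Carrier
    f (+ n)      = proj₁ (fwd n)
    f -[1+ k ]   = proj₁ (bwd (suc k))

-- The determinant D(N), read as a function of N ∈ ℤ, is a combination of f(N + (m+1)ℓ, x, s) and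
-- f(N + mℓ, x, qˡ s), which after these index shifts both solve the recurrence of f(·, x, q^{(m+1)ℓ} s).
-- Since s and q are units the recurrence can be run backwards too, so a solution vanishing at 0 is
-- D(1) · f(N, x, q^{(m+1)ℓ} s). Finally D(1) is the Casoratian at mℓ of the two solutions f(n + ℓ, x, s)
-- and f(n, x, qˡ s) of the recurrence with parameter qˡ s; a Casoratian gets multiplied by −qⁿ qˡ s
-- at each step and here starts at −f(ℓ, x, s).
module Submission where

open import Defs
open import Level using (Level)
open import Algebra.Bundles using (CommutativeRing)
open import Data.Nat as ℕ using (ℕ; zero; suc; _≥_; s≤s)
open import Data.Integer as ℤ using (ℤ; +_; -[1+_])
import Data.Nat.Properties as ℕₚ
import Data.Integer.Properties as ℤₚ
open import Data.Nat.DivMod using (m*n/n≡m)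
open import Data.Nat.Solver using (module +-*-Solver)
open import Data.Maybe using (Maybe; just; nothing)
open import Relation.Nullary using (yes; no)
open import Relation.Binary.PropositionalEquality as ≡ using (_≡_)
open import Algebra.Solver.Ring.AlmostCommutativeRing
  using (fromCommutativeRing; _-Raw-AlmostCommutative⟶_)

module TriangularNumbers where
  open import Data.Nat using (_+_; _*_; _∸_; _/_)
  open ≡.≡-Reasoning
  open +-*-Solver using (solve; _:+_; _:*_; _:=_; con)

  triangle : ℕ → ℕ
  triangle zero    = 0
  triangle (suc k) = k + triangle k

  triangle-double : ∀ k → triangle k * 2 + k ≡ k * k
  triangle-double zero    = ≡.refl
  triangle-double (suc k) = begin
    (k + triangle k) * 2 + suc k
      ≡⟨ solve 2 (λ k t → (k :+ t) :* con 2 :+ (con 1 :+ k) := t :* con 2 :+ k :+ (con 2 :* k :+ con 1))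
               ≡.refl k (triangle k) ⟩
    triangle k * 2 + k + (2 * k + 1)
      ≡⟨ ≡.cong (_+ (2 * k + 1)) (triangle-double k) ⟩
    k * k + (2 * k + 1)
      ≡⟨ solve 1 (λ k → k :* k :+ (con 2 :* k :+ con 1) := (con 1 :+ k) :* (con 1 :+ k)) ≡.refl k ⟩
    suc k * suc k
      ∎

  shifted-triangle-double : ∀ l′ k → (suc l′ * k + triangle k) * 2 ≡ k * (l′ + suc l′ + k)
  shifted-triangle-double l′ k = ℕₚ.+-cancelʳ-≡ k _ _ (begin
    (suc l′ * k + triangle k) * 2 + k
      ≡⟨ solve 3 (λ l′ k t → ((con 1 :+ l′) :* k :+ t) :* con 2 :+ k
                             := (con 1 :+ l′) :* k :* con 2 :+ (t :* con 2 :+ k))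
               ≡.refl l′ k (triangle k) ⟩
    suc l′ * k * 2 + (triangle k * 2 + k)
      ≡⟨ ≡.cong (λ e → suc l′ * k * 2 + e) (triangle-double k) ⟩
    suc l′ * k * 2 + k * k
      ≡⟨ solve 2 (λ l′ k → (con 1 :+ l′) :* k :* con 2 :+ k :* k := k :* (l′ :+ (con 1 :+ l′) :+ k) :+ k)
               ≡.refl l′ k ⟩
    k * (l′ + suc l′ + k) + k
      ∎)

  exponent-identity : ∀ l′ m → let l = suc l′; k = m * l in
    k * ((m + 2) * l ∸ 1) / 2 ≡ l * k + triangle k
  exponent-identity l′ m = begin
    k * ((m + 2) * l ∸ 1) / 2     ≡⟨ ≡.cong (λ e → k * (e ∸ 1) / 2) m+2-times-l ⟩
    k * (l′ + l + k) / 2          ≡⟨ ≡.cong (_/ 2) (shifted-triangle-double l′ k) ⟨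
    (l * k + triangle k) * 2 / 2  ≡⟨ m*n/n≡m (l * k + triangle k) 2 ⟩
    l * k + triangle k            ∎
    where
    l = suc l′
    k = m * l
    m+2-times-l : (m + 2) * l ≡ suc (l′ + l + k)
    m+2-times-l = solve 2 (λ m l′ → (m :+ con 2) :* (con 1 :+ l′)
                                    := con 1 :+ (l′ :+ (con 1 :+ l′) :+ m :* (con 1 :+ l′))) ≡.refl m l′

open TriangularNumbers using (triangle; exponent-identity)

ℤ-+-suc : ∀ i n → i ℤ.+ + suc n ≡ ℤ.suc (i ℤ.+ + n)
ℤ-+-suc i n = begin
  i ℤ.+ + suc n        ≡⟨ ℤₚ.+-comm i (+ suc n) ⟩
  + suc n ℤ.+ i        ≡⟨ ℤₚ.suc-+ n i ⟩
  ℤ.suc (+ n ℤ.+ i)    ≡⟨ ≡.cong ℤ.suc (ℤₚ.+-comm (+ n) i) ⟩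
  ℤ.suc (i ℤ.+ + n)    ∎
  where open ≡.≡-Reasoning

-- The ring solver over R with coefficients in ℤ; with R itself as coefficient ring the solver
-- could not cancel opposite terms, since equality of abstract coefficients is undecidable.
module IntegerCoefficients {c r : Level} (R : CommutativeRing c r) where
  open CommutativeRing R
  open import Algebra.Properties.Ring ring using (-‿involutive; -0#≈0#; -‿distribˡ-*)
  open import Algebra.Properties.AbelianGroup +-abelianGroup using (⁻¹-∙-comm; xyx⁻¹≈y)
  open import Algebra.Properties.Semiring.Mult.TCOptimised semiring using (_×_; ×-homo-+; 1+×)
  open import Relation.Binary.Reasoning.Setoid setoid

  fromℤ : ℤ → Carrier
  fromℤ (+ n)    = n × 1#
  fromℤ -[1+ n ] = - (suc n × 1#)

  fromℤ-cong : ∀ {i j} → i ≡ j → fromℤ i ≈ fromℤ j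
  fromℤ-cong ≡.refl = refl

  fromℤ-homo-⊖ : ∀ m n → fromℤ (m ℤ.⊖ n) ≈ m × 1# - n × 1#
  fromℤ-homo-⊖ m       zero    = sym (trans (+-congˡ -0#≈0#) (+-identityʳ _))
  fromℤ-homo-⊖ zero    (suc n) = sym (+-identityˡ _)
  fromℤ-homo-⊖ (suc m) (suc n) = begin
    fromℤ (suc m ℤ.⊖ suc n)        ≈⟨ fromℤ-cong (ℤₚ.[1+m]⊖[1+n]≡m⊖n m n) ⟩
    fromℤ (m ℤ.⊖ n)                ≈⟨ fromℤ-homo-⊖ m n ⟩
    a - b                          ≈⟨ xyx⁻¹≈y 1# (a - b) ⟨
    1# + (a - b) - 1#              ≈⟨ +-congʳ (+-assoc 1# a (- b)) ⟨
    1# + a - b - 1#                ≈⟨ +-assoc (1# + a) (- b) (- 1#) ⟩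
    (1# + a) + (- b - 1#)          ≈⟨ +-congˡ (trans (+-comm (- b) (- 1#)) (⁻¹-∙-comm 1# b)) ⟩
    (1# + a) - (1# + b)            ≈⟨ +-cong (1+× m 1#) (-‿cong (1+× n 1#)) ⟨
    suc m × 1# - suc n × 1#        ∎
    where a = m × 1#; b = n × 1#

  fromℤ-homo-+ : ∀ i j → fromℤ (i ℤ.+ j) ≈ fromℤ i + fromℤ j
  fromℤ-homo-+ (+ m)    (+ n)    = ×-homo-+ 1# m n
  fromℤ-homo-+ (+ m)    -[1+ n ] = fromℤ-homo-⊖ m (suc n)
  fromℤ-homo-+ -[1+ m ] (+ n)    = trans (fromℤ-homo-⊖ n (suc m)) (+-comm _ _)
  fromℤ-homo-+ -[1+ m ] -[1+ n ] = begin
    - (suc (suc (m ℕ.+ n)) × 1#)    ≡⟨ ≡.cong (λ k → - (suc k × 1#)) (ℕₚ.+-suc m n) ⟨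
    - ((suc m ℕ.+ suc n) × 1#)      ≈⟨ -‿cong (×-homo-+ 1# (suc m) (suc n)) ⟩
    - (suc m × 1# + suc n × 1#)     ≈⟨ ⁻¹-∙-comm _ _ ⟨
    - (suc m × 1#) - (suc n × 1#)   ∎

  fromℤ-homo-neg : ∀ i → fromℤ (ℤ.- i) ≈ - fromℤ i
  fromℤ-homo-neg (+ zero)  = sym -0#≈0#
  fromℤ-homo-neg (+ suc n) = refl
  fromℤ-homo-neg -[1+ n ]  = sym (-‿involutive _)

  fromℤ-homo-*⁺ : ∀ m j → fromℤ (+ m ℤ.* j) ≈ m × 1# * fromℤ j
  fromℤ-homo-*⁺ zero    j = sym (zeroˡ (fromℤ j))
  fromℤ-homo-*⁺ (suc m) j = begin
    fromℤ (+ suc m ℤ.* j)            ≈⟨ fromℤ-cong (ℤₚ.suc-* (+ m) j) ⟩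
    fromℤ (j ℤ.+ + m ℤ.* j)          ≈⟨ fromℤ-homo-+ j (+ m ℤ.* j) ⟩
    fromℤ j + fromℤ (+ m ℤ.* j)      ≈⟨ +-cong (*-identityˡ (fromℤ j)) (sym (fromℤ-homo-*⁺ m j)) ⟨
    1# * fromℤ j + m × 1# * fromℤ j  ≈⟨ distribʳ (fromℤ j) 1# (m × 1#) ⟨
    (1# + m × 1#) * fromℤ j          ≈⟨ *-congʳ (1+× m 1#) ⟨
    suc m × 1# * fromℤ j             ∎

  fromℤ-homo-* : ∀ i j → fromℤ (i ℤ.* j) ≈ fromℤ i * fromℤ j
  fromℤ-homo-* (+ m)    j = fromℤ-homo-*⁺ m j
  fromℤ-homo-* -[1+ m ] j = begin
    fromℤ (-[1+ m ] ℤ.* j)           ≈⟨ fromℤ-cong (ℤₚ.neg-distribˡ-* (+ suc m) j) ⟨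
    fromℤ (ℤ.- (+ suc m ℤ.* j))      ≈⟨ fromℤ-homo-neg (+ suc m ℤ.* j) ⟩
    - fromℤ (+ suc m ℤ.* j)          ≈⟨ -‿cong (fromℤ-homo-*⁺ (suc m) j) ⟩
    - (suc m × 1# * fromℤ j)         ≈⟨ -‿distribˡ-* _ _ ⟩
    fromℤ -[1+ m ] * fromℤ j         ∎

  homomorphism : ℤ.+-*-rawRing -Raw-AlmostCommutative⟶ fromCommutativeRing R
  homomorphism = record
    { ⟦_⟧ = fromℤ ; +-homo = fromℤ-homo-+ ; *-homo = fromℤ-homo-* ; -‿homo = fromℤ-homo-neg
    ; 0-homo = refl ; 1-homo = refl }

  fromℤ-equal? : ∀ i j → Maybe (fromℤ i ≈ fromℤ j)
  fromℤ-equal? i j with i ℤ.≟ j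
  ... | yes ≡.refl = just refl
  ... | no _       = nothing

  open import Algebra.Solver.Ring ℤ.+-*-rawRing (fromCommutativeRing R) homomorphism fromℤ-equal? public

module QFibonacci {ℓ₁ ℓ₂ : Level} (R : CommutativeRing ℓ₁ ℓ₂) where
  open CommutativeRing R hiding (zero)
  open QFib R
  open import Data.Product using (_×_; _,_; proj₁; proj₂)
  open IntegerCoefficients R using (solve; _:+_; _:-_; _:*_; :-_; _:=_; con)
  open import Algebra.Properties.Group +-group using () renaming (∙-cancelˡ to +-cancelˡ)
  open import Algebra.Properties.CommutativeSemigroup *-commutativeSemigroup using (x∙yz≈y∙xz)
  open import Relation.Binary.Reasoning.Setoid setoid

  inverse-cancelˡ : ∀ {a b} → a * b ≈ 1# → ∀ y → a * (b * y) ≈ y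
  inverse-cancelˡ {a} {b} a*b≈1 y = begin
    a * (b * y)  ≈⟨ *-assoc a b y ⟨
    a * b * y    ≈⟨ *-congʳ a*b≈1 ⟩
    1# * y       ≈⟨ *-identityˡ y ⟩
    y            ∎

  unit-cancelˡ : ∀ {a b y z} → a * b ≈ 1# → a * y ≈ a * z → y ≈ z
  unit-cancelˡ {a} {b} {y} {z} a*b≈1 a*y≈a*z = begin
    y            ≈⟨ inverse-cancelˡ b*a≈1 y ⟨
    b * (a * y)  ≈⟨ *-congˡ a*y≈a*z ⟩
    b * (a * z)  ≈⟨ inverse-cancelˡ b*a≈1 z ⟩
    z            ∎
    where b*a≈1 = trans (*-comm b a) a*b≈1

  *-inverse : ∀ {a a′ b b′} → a * a′ ≈ 1# → b * b′ ≈ 1# → (a * b) * (a′ * b′) ≈ 1#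
  *-inverse {a} {a′} {b} {b′} a*a′≈1 b*b′≈1 = begin
    a * b * (a′ * b′)    ≈⟨ solve 4 (λ a b a′ b′ → a :* b :* (a′ :* b′) := a :* a′ :* (b :* b′))
                                  refl a b a′ b′ ⟩
    a * a′ * (b * b′)    ≈⟨ *-cong a*a′≈1 b*b′≈1 ⟩
    1# * 1#              ≈⟨ *-identityˡ 1# ⟩
    1#                   ∎

  pow-inverse : ∀ {a b} → a * b ≈ 1# → ∀ n → pow a n * pow b n ≈ 1#
  pow-inverse a*b≈1 zero    = *-identityˡ 1#
  pow-inverse a*b≈1 (suc n) = *-inverse a*b≈1 (pow-inverse a*b≈1 n)

  pow-homo-* : ∀ a m n → pow a (m ℕ.+ n) ≈ pow a m * pow a n
  pow-homo-* a zero    n = sym (*-identityˡ _)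
  pow-homo-* a (suc m) n = trans (*-congˡ (pow-homo-* a m n)) (sym (*-assoc _ _ _))

  pow-distrib-* : ∀ a b n → pow (a * b) n ≈ pow a n * pow b n
  pow-distrib-* a b zero    = sym (*-identityˡ 1#)
  pow-distrib-* a b (suc n) = trans (*-congˡ (pow-distrib-* a b n))
    (solve 4 (λ a b A B → a :* b :* (A :* B) := a :* A :* (b :* B)) refl a b (pow a n) (pow b n))

  pow-assocʳ : ∀ a m n → pow (pow a m) n ≈ pow a (m ℕ.* n)
  pow-assocʳ a m zero    = reflexive (≡.cong (pow a) (≡.sym (ℕₚ.*-zeroʳ m)))
  pow-assocʳ a m (suc n) = begin
    pow a m * pow (pow a m) n   ≈⟨ *-congˡ (pow-assocʳ a m n) ⟩
    pow a m * pow a (m ℕ.* n)   ≈⟨ pow-homo-* a m (m ℕ.* n) ⟨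
    pow a (m ℕ.+ m ℕ.* n)       ≡⟨ ≡.cong (pow a) (ℕₚ.*-suc m n) ⟨
    pow a (m ℕ.* suc n)         ∎

  signPow-pred : ∀ k → signPow (+ k ℤ.- + 1) ≈ pow (- 1#) (suc k)
  signPow-pred zero    = refl
  signPow-pred (suc k) = solve 1 (λ σ → σ := :- con (+ 1) :* (:- con (+ 1) :* σ)) refl (pow (- 1#) k)

  module _ (q qinv x : Carrier) (q*qinv≈1 : q * qinv ≈ 1#) where

    qPow : ℤ → Carrier
    qPow (+ n)    = pow q n
    qPow -[1+ n ] = pow qinv (suc n)

    qPow-suc : ∀ i → qPow (ℤ.suc i) ≈ q * qPow i
    qPow-suc (+ n)          = refl
    qPow-suc -[1+ zero ]    = sym (inverse-cancelˡ q*qinv≈1 1#)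
    qPow-suc -[1+ suc n ]   = sym (inverse-cancelˡ q*qinv≈1 (pow qinv (suc n)))

    qPow-homo-* : ∀ i n → qPow (i ℤ.+ + n) ≈ qPow i * pow q n
    qPow-homo-* i zero    = trans (reflexive (≡.cong qPow (ℤₚ.+-identityʳ i))) (sym (*-identityʳ _))
    qPow-homo-* i (suc n) = begin
      qPow (i ℤ.+ + suc n)        ≡⟨ ≡.cong qPow (ℤ-+-suc i n) ⟩
      qPow (ℤ.suc (i ℤ.+ + n))    ≈⟨ qPow-suc (i ℤ.+ + n) ⟩
      q * qPow (i ℤ.+ + n)        ≈⟨ *-congˡ (qPow-homo-* i n) ⟩
      q * (qPow i * pow q n)      ≈⟨ x∙yz≈y∙xz q (qPow i) (pow q n) ⟩
      qPow i * (q * pow q n)      ∎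

    qPow-inverse : ∀ i → qPow i * qPow (ℤ.- i) ≈ 1#
    qPow-inverse (+ zero)  = *-identityˡ 1#
    qPow-inverse (+ suc n) = pow-inverse q*qinv≈1 (suc n)
    qPow-inverse -[1+ n ]  = pow-inverse (trans (*-comm qinv q) q*qinv≈1) (suc n)

    IsSolution : Carrier → (ℤ → Carrier) → Set ℓ₂
    IsSolution t h = ∀ n → h (ℤ.suc (ℤ.suc n)) ≈ x * h (ℤ.suc n) + qPow n * t * h n

    module _ {t tinv : Carrier} where
      private
        F : ℤ → Carrier
        F = f q x t tinv

      f-neg : ∀ k → F (ℤ.- + k) ≡ proj₁ (bwd q x t tinv k)
      f-neg zero    = ≡.refl
      f-neg (suc k) = ≡.refl

      f-suc-neg : ∀ k → F (ℤ.suc (ℤ.- + k)) ≡ proj₂ (bwd q x t tinv k)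
      f-suc-neg zero    = ≡.refl
      f-suc-neg (suc k) = ≡.trans (≡.cong F (ℤₚ.1-[1+n]≡-n k)) (f-neg k)

      f-isSolution : t * tinv ≈ 1# → IsSolution t F
      f-isSolution _        (+ n)    = refl
      f-isSolution t*tinv≈1 -[1+ k ] = begin
        F (ℤ.suc (ℤ.suc -[1+ k ]))     ≡⟨ ≡.cong (λ i → F (ℤ.suc i)) (ℤₚ.1-[1+n]≡-n k) ⟩
        F (ℤ.suc (ℤ.- + k))            ≡⟨ f-suc-neg k ⟩
        b                              ≈⟨ solve 2 (λ xa b → b := xa :+ (b :- xa)) refl (x * a) b ⟩
        x * a + (b - x * a)            ≈⟨ +-congˡ (inverse-cancelˡ u*v≈1 (b - x * a)) ⟨
        x * a + u * F -[1+ k ]         ≡⟨ ≡.cong (λ y → x * y + u * F -[1+ k ])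
                                                 (≡.trans (≡.cong F (ℤₚ.1-[1+n]≡-n k)) (f-neg k)) ⟨
        x * F (ℤ.suc -[1+ k ]) + u * F -[1+ k ]  ∎
        where
        a = proj₁ (bwd q x t tinv k)
        b = proj₂ (bwd q x t tinv k)
        u = pow qinv (suc k) * t
        u*v≈1 : u * (pow q (suc k) * tinv) ≈ 1#
        u*v≈1 = *-inverse (pow-inverse (trans (*-comm qinv q) q*qinv≈1) (suc k)) t*tinv≈1

    isSolution-resp : ∀ {t t′ h} → t ≈ t′ → IsSolution t h → IsSolution t′ h
    isSolution-resp t≈t′ sol n = trans (sol n) (+-congˡ (*-congʳ (*-congˡ t≈t′)))

    isSolution-shift : ∀ {t h} k → IsSolution t h → IsSolution (pow q k * t) (λ n → h (n ℤ.+ + k))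
    isSolution-shift {t} {h} k sol n = begin
      h (ℤ.suc (ℤ.suc n) ℤ.+ + k)
        ≡⟨ ≡.cong h (≡.trans (suc-+ (ℤ.suc n)) (≡.cong ℤ.suc (suc-+ n))) ⟩
      h (ℤ.suc (ℤ.suc (n ℤ.+ + k)))
        ≈⟨ sol (n ℤ.+ + k) ⟩
      x * h (ℤ.suc (n ℤ.+ + k)) + qPow (n ℤ.+ + k) * t * h (n ℤ.+ + k)
        ≈⟨ +-cong (reflexive (≡.cong (λ i → x * h i) (≡.sym (suc-+ n))))
                  (*-congʳ (trans (*-congʳ (qPow-homo-* n k)) (*-assoc _ _ _))) ⟩
      x * h (ℤ.suc n ℤ.+ + k) + qPow n * (pow q k * t) * h (n ℤ.+ + k)  ∎
      where
      suc-+ : ∀ i → ℤ.suc i ℤ.+ + k ≡ ℤ.suc (i ℤ.+ + k)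
      suc-+ i = ℤₚ.+-assoc (+ 1) i (+ k)

    isSolution-scale : ∀ {t h} a → IsSolution t h → IsSolution t (λ n → a * h n)
    isSolution-scale {t} {h} a sol n = begin
      a * h (ℤ.suc (ℤ.suc n))
        ≈⟨ *-congˡ (sol n) ⟩
      a * (x * h (ℤ.suc n) + c * h n)
        ≈⟨ solve 5 (λ a x h₁ c h₀ → a :* (x :* h₁ :+ c :* h₀) := x :* (a :* h₁) :+ c :* (a :* h₀))
                   refl a x _ c _ ⟩
      x * (a * h (ℤ.suc n)) + c * (a * h n)
        ∎
      where c = qPow n * t

    isSolution-combination : ∀ {t g h} a b → IsSolution t g → IsSolution t h →
                             IsSolution t (λ n → g n * a - b * h n)
    isSolution-combination {t} {g} {h} a b sol-g sol-h n = begin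
      g (ℤ.suc (ℤ.suc n)) * a - b * h (ℤ.suc (ℤ.suc n))
        ≈⟨ +-cong (*-congʳ (sol-g n)) (-‿cong (*-congˡ (sol-h n))) ⟩
      (x * g (ℤ.suc n) + c * g n) * a - b * (x * h (ℤ.suc n) + c * h n)
        ≈⟨ solve 8 (λ x c g₁ g₀ h₁ h₀ a b →
                     (x :* g₁ :+ c :* g₀) :* a :- b :* (x :* h₁ :+ c :* h₀)
                     := x :* (g₁ :* a :- b :* h₁) :+ c :* (g₀ :* a :- b :* h₀))
                   refl x c _ _ _ _ a b ⟩
      x * (g (ℤ.suc n) * a - b * h (ℤ.suc n)) + c * (g n * a - b * h n)  ∎
      where c = qPow n * t

    module _ {t tinv : Carrier} (t*tinv≈1 : t * tinv ≈ 1#) {g h : ℤ → Carrier}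
             (sol-g : IsSolution t g) (sol-h : IsSolution t h) where

      private
        AgreeAt : ℤ → Set ℓ₂
        AgreeAt n = g n ≈ h n × g (ℤ.suc n) ≈ h (ℤ.suc n)

        agree-suc : ∀ n → AgreeAt n → AgreeAt (ℤ.suc n)
        agree-suc n (g₀≈h₀ , g₁≈h₁) = g₁≈h₁ , (begin
          g (ℤ.suc (ℤ.suc n))                       ≈⟨ sol-g n ⟩
          x * g (ℤ.suc n) + qPow n * t * g n        ≈⟨ +-cong (*-congˡ g₁≈h₁) (*-congˡ g₀≈h₀) ⟩
          x * h (ℤ.suc n) + qPow n * t * h n        ≈⟨ sol-h n ⟨
          h (ℤ.suc (ℤ.suc n))                       ∎)

        agree-pred : ∀ n → AgreeAt (ℤ.suc n) → AgreeAt n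
        agree-pred n (g₁≈h₁ , g₂≈h₂) = unit-cancelˡ c-unit (+-cancelˡ (x * g (ℤ.suc n)) _ _ (begin
          x * g (ℤ.suc n) + c * g n     ≈⟨ sol-g n ⟨
          g (ℤ.suc (ℤ.suc n))           ≈⟨ g₂≈h₂ ⟩
          h (ℤ.suc (ℤ.suc n))           ≈⟨ sol-h n ⟩
          x * h (ℤ.suc n) + c * h n     ≈⟨ +-congʳ (*-congˡ g₁≈h₁) ⟨
          x * g (ℤ.suc n) + c * h n     ∎)) , g₁≈h₁
          where
          c = qPow n * t
          c-unit : c * (qPow (ℤ.- n) * tinv) ≈ 1#
          c-unit = *-inverse (qPow-inverse n) t*tinv≈1

        agree-everywhere : AgreeAt (+ 0) → ∀ n → AgreeAt n
        agree-everywhere a₀ (+ zero)      = a₀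
        agree-everywhere a₀ (+ suc n)     = agree-suc (+ n) (agree-everywhere a₀ (+ n))
        agree-everywhere a₀ -[1+ zero ]   = agree-pred -[1+ zero ] a₀
        agree-everywhere a₀ -[1+ suc n ]  = agree-pred -[1+ suc n ] (agree-everywhere a₀ -[1+ n ])

      isSolution-unique : g (+ 0) ≈ h (+ 0) → g (+ 1) ≈ h (+ 1) → ∀ n → g n ≈ h n
      isSolution-unique g₀≈h₀ g₁≈h₁ n = proj₁ (agree-everywhere (g₀≈h₀ , g₁≈h₁) n)

    isSolution≈multiple-of-f : ∀ {t tinv h} → t * tinv ≈ 1# → IsSolution t h → h (+ 0) ≈ 0# →
                               ∀ n → h n ≈ h (+ 1) * f q x t tinv n
    isSolution≈multiple-of-f {h = h} t*tinv≈1 sol h₀≈0 =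
      isSolution-unique t*tinv≈1 sol (isSolution-scale (h (+ 1)) (f-isSolution t*tinv≈1))
        (trans h₀≈0 (sym (zeroʳ (h (+ 1))))) (sym (*-identityʳ (h (+ 1))))

    casoratian : (ℤ → Carrier) → (ℤ → Carrier) → ℤ → Carrier
    casoratian g h n = g (ℤ.suc n) * h n - g n * h (ℤ.suc n)

    casoratian-suc : ∀ {t g h} → IsSolution t g → IsSolution t h → ∀ n →
                     casoratian g h (ℤ.suc n) ≈ - (qPow n * t) * casoratian g h n
    casoratian-suc {t} {g} {h} sol-g sol-h n = begin
      g₂ * h₁ - g₁ * h₂
        ≈⟨ +-cong (*-congʳ (sol-g n)) (-‿cong (*-congˡ (sol-h n))) ⟩
      (x * g₁ + c * g₀) * h₁ - g₁ * (x * h₁ + c * h₀)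
        ≈⟨ solve 6 (λ x c g₁ g₀ h₁ h₀ → (x :* g₁ :+ c :* g₀) :* h₁ :- g₁ :* (x :* h₁ :+ c :* h₀)
                     := :- c :* (g₁ :* h₀ :- g₀ :* h₁)) refl x c g₁ g₀ h₁ h₀ ⟩
      - c * (g₁ * h₀ - g₀ * h₁)                             ∎
      where
      c = qPow n * t
      g₀ = g n; g₁ = g (ℤ.suc n); g₂ = g (ℤ.suc (ℤ.suc n))
      h₀ = h n; h₁ = h (ℤ.suc n); h₂ = h (ℤ.suc (ℤ.suc n))

    casoratian-closed : ∀ {t g h} → IsSolution t g → IsSolution t h → ∀ j →
      casoratian g h (+ j) ≈ pow (- 1#) j * pow t j * pow q (triangle j) * casoratian g h (+ 0)
    casoratian-closed sol-g sol-h zero    =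
      solve 1 (λ C → C := con (+ 1) :* con (+ 1) :* con (+ 1) :* C) refl _
    casoratian-closed {t} {g} {h} sol-g sol-h (suc j) = begin
      casoratian g h (+ suc j)
        ≈⟨ casoratian-suc sol-g sol-h (+ j) ⟩
      - (pow q j * t) * casoratian g h (+ j)
        ≈⟨ *-congˡ (casoratian-closed sol-g sol-h j) ⟩
      - (pow q j * t) * (σ * T * Q * C₀)
        ≈⟨ solve 6 (λ qʲ t σ T Q C₀ → :- (qʲ :* t) :* (σ :* T :* Q :* C₀)
                                      := :- con (+ 1) :* σ :* (t :* T) :* (qʲ :* Q) :* C₀)
                   refl (pow q j) t σ T Q C₀ ⟩
      - 1# * σ * (t * T) * (pow q j * Q) * C₀
        ≈⟨ *-congʳ (*-congˡ (pow-homo-* q j (triangle j))) ⟨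
      - 1# * σ * (t * T) * pow q (j ℕ.+ triangle j) * C₀
        ∎
      where
      σ = pow (- 1#) j; T = pow t j; Q = pow q (triangle j); C₀ = casoratian g h (+ 0)

    module Determinant {s sinv : Carrier} (s*sinv≈1 : s * sinv ≈ 1#) (l m : ℕ) where
      private
        k K : ℕ
        k = m ℕ.* l
        K = suc m ℕ.* l

        F G : ℤ → Carrier
        F = f q x s sinv
        G = f q x (pow q l * s) (pow qinv l * sinv)

        scaled-unit : ∀ j → pow q j * s * (pow qinv j * sinv) ≈ 1#
        scaled-unit j = *-inverse (pow-inverse q*qinv≈1 j) s*sinv≈1

        F-isSolution : IsSolution s F
        F-isSolution = f-isSolution s*sinv≈1

        G-isSolution : IsSolution (pow q l * s) G
        G-isSolution = f-isSolution (scaled-unit l)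

      D : ℤ → Carrier
      D n = F (n ℤ.+ + K) * G (+ k) - F (+ K) * G (n ℤ.+ + k)

      D-isSolution : IsSolution (pow q K * s) D
      D-isSolution = isSolution-combination (G (+ k)) (F (+ K)) (isSolution-shift K F-isSolution)
                       (isSolution-resp shifted-parameter (isSolution-shift k G-isSolution))
        where
        shifted-parameter : pow q k * (pow q l * s) ≈ pow q K * s
        shifted-parameter = begin
          pow q k * (pow q l * s)   ≈⟨ solve 3 (λ a b c → a :* (b :* c) := b :* a :* c)
                                               refl (pow q k) (pow q l) s ⟩
          pow q l * pow q k * s     ≈⟨ *-congʳ (pow-homo-* q l k) ⟨
          pow q (l ℕ.+ k) * s       ∎

      D-zero : D (+ 0) ≈ 0#
      D-zero = -‿inverseʳ (F (+ K) * G (+ k))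

      D≈D₁*f : ∀ n → D n ≈ D (+ 1) * f q x (pow q K * s) (pow qinv K * sinv) n
      D≈D₁*f = isSolution≈multiple-of-f (scaled-unit K) D-isSolution D-zero

      D₁-closed : D (+ 1) ≈ pow (- 1#) (suc k) * pow s k * pow q (l ℕ.* k ℕ.+ triangle k) * F (+ l)
      D₁-closed = begin
        D (+ 1)
          ≡⟨ ≡.cong (λ j → F (+ suc j) * G (+ k) - F (+ j) * G (+ suc k)) (ℕₚ.+-comm l k) ⟩
        casoratian Fₗ G (+ k)
          ≈⟨ casoratian-closed (isSolution-shift l F-isSolution) G-isSolution k ⟩
        σ * pow (pow q l * s) k * Q * casoratian Fₗ G (+ 0)
          ≈⟨ *-cong (*-congʳ (*-congˡ (pow-distrib-* (pow q l) s k))) casoratian-at-0 ⟩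
        σ * (pow (pow q l) k * pow s k) * Q * - F (+ l)
          ≈⟨ solve 5 (λ σ Qₗ S Q F → σ :* (Qₗ :* S) :* Q :* (:- F)
                                     := :- con (+ 1) :* σ :* S :* (Qₗ :* Q) :* F)
                     refl σ (pow (pow q l) k) (pow s k) Q (F (+ l)) ⟩
        - 1# * σ * pow s k * (pow (pow q l) k * Q) * F (+ l)
          ≈⟨ *-congʳ (*-congˡ (*-congʳ (pow-assocʳ q l k))) ⟩
        - 1# * σ * pow s k * (pow q (l ℕ.* k) * Q) * F (+ l)
          ≈⟨ *-congʳ (*-congˡ (pow-homo-* q (l ℕ.* k) (triangle k))) ⟨
        - 1# * σ * pow s k * pow q (l ℕ.* k ℕ.+ triangle k) * F (+ l) ∎
        where
        Fₗ : ℤ → Carrier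
        Fₗ n = F (n ℤ.+ + l)
        σ = pow (- 1#) k
        Q = pow q (triangle k)
        casoratian-at-0 : casoratian Fₗ G (+ 0) ≈ - F (+ l)
        casoratian-at-0 = solve 2 (λ a b → a :* con (+ 0) :- b :* con (+ 1) := :- b)
                                  refl (F (+ suc l)) (F (+ l))

mainTheorem3 : ∀ {c r : Level} (R : CommutativeRing c r) →
  let open CommutativeRing R
      open QFib R
  in (q qinv x s sinv : Carrier) → q * qinv ≈ 1# → s * sinv ≈ 1# →
     (l m : ℕ) → l ≥ 1 → (N : ℤ) →
     let s' = pow q l * s
         s'inv = pow qinv l * sinv
         s''   = pow q ((suc m) ℕ.* l) * s
         s''inv = pow qinv ((suc m) ℕ.* l) * sinv
     in (f q x s sinv (N ℤ.+ + ((suc m) ℕ.* l)) * f q x s' s'inv (+ (m ℕ.* l))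
         - f q x s sinv (+ ((suc m) ℕ.* l)) * f q x s' s'inv (N ℤ.+ + (m ℕ.* l)))
        ≈ signPow (+ (m ℕ.* l) ℤ.- + 1)
          * pow s (m ℕ.* l)
          * pow q ((m ℕ.* l ℕ.* ((m ℕ.+ 2) ℕ.* l ℕ.∸ 1)) ℕ./ 2)
          * f q x s sinv (+ l)
          * f q x s'' s''inv N
mainTheorem3 R q qinv x s sinv q*qinv≈1 s*sinv≈1 (suc l′) m (s≤s _) N = begin
  D N
    ≈⟨ D≈D₁*f N ⟩
  D (+ 1) * f″ N
    ≈⟨ *-congʳ D₁-closed ⟩
  pow (- 1#) (suc k) * pow s k * pow q (l ℕ.* k ℕ.+ triangle k) * F (+ l) * f″ N
    ≈⟨ *-congʳ (*-congʳ (*-cong (*-congʳ (signPow-pred k)) (reflexive (≡.cong (pow q) exponent)))) ⟨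
  signPow (+ k ℤ.- + 1) * pow s k * pow q (k ℕ.* ((m ℕ.+ 2) ℕ.* l ℕ.∸ 1) ℕ./ 2) * F (+ l) * f″ N
    ∎
  where
  open CommutativeRing R
  open QFib R
  open QFibonacci R
  open Determinant q qinv x q*qinv≈1 s*sinv≈1 (suc l′) m
  open import Relation.Binary.Reasoning.Setoid setoid
  l = suc l′
  k = m ℕ.* l
  F = f q x s sinv
  f″ = f q x (pow q (suc m ℕ.* l) * s) (pow qinv (suc m ℕ.* l) * sinv)
  exponent = exponent-identity l′ m
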